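{- For an odd integer $n\geq 3$, let $A$ be a board of size $n$ chosen uniformly at random from the set $\mathrm{Mat}_{n\times n}(\mathcal{D})$ of all $8^{n^2}$ boards of size $n$. Then $$\lim_{n\to\infty}\ \mathrm{Prob}_{A\in \mathrm{Mat}_{n\times n}(\mathcal{D})}(A \text{ is solvable}) = \frac{3}{8},$$ where the limit is taken over odd $n$.
   Context: Let $\mathcal{D}=\{\mathrm{N},\mathrm{NE},\mathrm{E},\mathrm{SE},\mathrm{S},\mathrm{SW},\mathrm{W},\mathrm{NW}\}$ (the 8 compass directions). For odd $n\geq 3$, a board of size $n$ is an $n\times n$ matrix $A=(a_{ij})$ with entries in $\mathcal{D}$; rows are indexed $1,\dots,n$ from top to bottom and columns $1,\dots,n$ from left to right. For $(i',j')\neq(i,j)$, the entry $a_{ij}$ is directing to $(i',j')$ if: N: $j'=j$, $i'<i$; NE: $i-i'=j'-j>0$; E: $i'=i$, $j'>j$; SE: $i'-i=j'-j>0$; S: $j'=j$, $i'>i$; SW: $i'-i=j-j'>0$; W: $i'=i$, $j'<j$; NW: $i-i'=j-j'>0$. A move goes from position $(i,j)$ to any position to which $a_{ij}$ is directing. The board $A$ is solvable if there is a finite sequence of moves starting at $(1,1)$ and ending at the center $(\frac{n+1}{2},\frac{n+1}{2})$. The probability is with respect to the uniform measure on the $8^{n^2}$ boards (equivalently, each entry independently uniform on $\mathcal{D}$). -}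

module Defs where

open import Data.Nat using (ℕ; zero; suc; _+_; _*_; _∸_; _^_; _<_; _≤_)
open import Data.Nat.Properties using (m^n≢0)
open import Data.Fin using (Fin; toℕ; fromℕ<)
open import Data.Product using (_×_; _,_)
open import Data.Vec using (Vec; lookup)
open import Data.Integer using (+_)
open import Data.Rational using (ℚ; _/_)
open import Relation.Binary.PropositionalEquality using (_≡_)
open import Relation.Binary.Construct.Closure.ReflexiveTransitive using (Star)
open import Data.Nat.Properties using (≤-refl; m≤m+n)

data Dir : Set where
  N NE E SE S SW W NW : Dir

-- A board of size n: an n×n matrix (row-major, vector of rows) of directions.
-- Indices are 0-based: row 0 is the top row, column 0 the leftmost column.
Board : ℕ → Set
Board n = Vec (Vec Dir n) n

Pos : ℕ → Set
Pos n = Fin n × Fin n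

Directing : ∀ {n} → Dir → Pos n → Pos n → Set
Directing N  (i , j) (i' , j') = toℕ j' ≡ toℕ j × toℕ i' < toℕ i
Directing NE (i , j) (i' , j') = toℕ i' < toℕ i × toℕ j < toℕ j' × toℕ i ∸ toℕ i' ≡ toℕ j' ∸ toℕ j
Directing E  (i , j) (i' , j') = toℕ i' ≡ toℕ i × toℕ j < toℕ j'
Directing SE (i , j) (i' , j') = toℕ i < toℕ i' × toℕ j < toℕ j' × toℕ i' ∸ toℕ i ≡ toℕ j' ∸ toℕ j
Directing S  (i , j) (i' , j') = toℕ j' ≡ toℕ j × toℕ i < toℕ i'
Directing SW (i , j) (i' , j') = toℕ i < toℕ i' × toℕ j' < toℕ j × toℕ i' ∸ toℕ i ≡ toℕ j ∸ toℕ j'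
Directing W  (i , j) (i' , j') = toℕ i' ≡ toℕ i × toℕ j' < toℕ j
Directing NW (i , j) (i' , j') = toℕ i' < toℕ i × toℕ j' < toℕ j × toℕ i ∸ toℕ i' ≡ toℕ j ∸ toℕ j'

Move : ∀ {n} → Board n → Pos n → Pos n → Set
Move A (i , j) q = Directing (lookup (lookup A i) j) (i , j) q

-- Odd sizes are written n = 2m+1 (the paper's n ≥ 3 corresponds to m ≥ 1).
oddSize : ℕ → ℕ
oddSize m = suc (2 * m)

start : ∀ m → Pos (oddSize m)
start m = Fin.zero , Fin.zero
  where import Data.Fin as Fin

-- Centre (paper's ((n+1)/2,(n+1)/2)), 0-based index m.
centreIdx : ∀ m → Fin (oddSize m)
centreIdx m = fromℕ< {m} (Data.Nat.s≤s (m≤m+n m (m + 0)))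
  where import Data.Nat

centre : ∀ m → Pos (oddSize m)
centre m = centreIdx m , centreIdx m

Solvable : ∀ m → Board (oddSize m) → Set
Solvable m A = Star (Move A) (start m) (centre m)

over8^ : ℕ → ℕ → ℚ
over8^ n k = _/_ (+ k) (8 ^ (n * n)) {{m^n≢0 8 (n * n)}}

{-# OPTIONS --safe #-}
module Submission where

-- Write n = 2m + 1.  A solvable board must leave the corner (1,1), so its corner
-- entry is E, SE or S: probability 3/8.  Conversely SE points straight at the
-- centre, and a corner S (resp. E) board is solvable as soon as, for some
-- 1 < i ≤ m, row i (resp. column i) offers the route (1,1) → (i,1) → (i,i) → centre,
-- i.e. a(i,1) = E (resp. a(1,i) = S) and a(i,i) = SE.  These m - 1 events involve
-- disjoint cells and have probability 1/64 each, so both failure probabilities are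
-- (63/64)^(m-1), which Bernoulli's inequality bounds by O(1/m).

module Reachability where

  open import Data.List using (List; []; _∷_)
  open import Data.List.Membership.Propositional using (_∈_)
  open import Data.List.Relation.Binary.Subset.Propositional using (_⊆_)
  open import Data.List.Relation.Unary.Any using (here; there)
  open import Data.Product using (_×_; _,_)
  open import Data.Sum using (_⊎_; inj₁; inj₂)
  open import Relation.Binary.Construct.Closure.ReflexiveTransitive using (Star; ε; _◅_)
  open import Relation.Binary.Definitions using (DecidableEquality)
  open import Relation.Binary.PropositionalEquality using (_≡_; refl)
  open import Relation.Nullary using (Dec)
  open import Relation.Nullary.Decidable using (map′; _⊎-dec_; _×-dec_)

  module _ {V : Set} (R : V → V → Set) where

    data Via (S : List V) : V → V → Set where
      hop    : ∀ {x y} → R x y → Via S x y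
      _◅⟨_⟩_ : ∀ {x z y} → R x z → z ∈ S → Via S z y → Via S x y

    private variable S S′ : List V

    Via-mono : S ⊆ S′ → ∀ {x y} → Via S x y → Via S′ x y
    Via-mono S⊆S′ (hop r)        = hop r
    Via-mono S⊆S′ (r ◅⟨ z∈S ⟩ p) = r ◅⟨ S⊆S′ z∈S ⟩ Via-mono S⊆S′ p

    Via-trans : ∀ {x v y} → Via S x v → v ∈ S → Via S v y → Via S x y
    Via-trans (hop r)        v∈S q = r ◅⟨ v∈S ⟩ q
    Via-trans (r ◅⟨ z∈S ⟩ p) v∈S q = r ◅⟨ z∈S ⟩ Via-trans p v∈S q

    Via-∷⁺ : ∀ {v x y} → Via S x y ⊎ (Via S x v × Via S v y) → Via (v ∷ S) x y
    Via-∷⁺ (inj₁ p)       = Via-mono there p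
    Via-∷⁺ (inj₂ (p , q)) = Via-trans (Via-mono there p) (here refl) (Via-mono there q)

    -- Cuts out the stretch between the first and the last visit to v.
    Via-∷⁻ : ∀ {v x y} → Via (v ∷ S) x y → Via S x y ⊎ (Via S x v × Via S v y)
    Via-∷⁻ (hop r) = inj₁ (hop r)
    Via-∷⁻ (r ◅⟨ here refl ⟩ p) with Via-∷⁻ p
    ... | inj₁ q       = inj₂ (hop r , q)
    ... | inj₂ (_ , q) = inj₂ (hop r , q)
    Via-∷⁻ (r ◅⟨ there z∈S ⟩ p) with Via-∷⁻ p
    ... | inj₁ q         = inj₁ (r ◅⟨ z∈S ⟩ q)
    ... | inj₂ (q₁ , q₂) = inj₂ (r ◅⟨ z∈S ⟩ q₁ , q₂)

    Via⇒Star : ∀ {x y} → Via S x y → Star R x y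
    Via⇒Star (hop r)      = r ◅ ε
    Via⇒Star (r ◅⟨ _ ⟩ p) = r ◅ Via⇒Star p

    ≡⊎Via⇒Star : ∀ {x y} → x ≡ y ⊎ Via S x y → Star R x y
    ≡⊎Via⇒Star (inj₁ refl) = ε
    ≡⊎Via⇒Star (inj₂ p)    = Via⇒Star p

    Star⇒≡⊎Via : ∀ {vs} → (∀ v → v ∈ vs) → ∀ {x y} → Star R x y → x ≡ y ⊎ Via vs x y
    Star⇒≡⊎Via all∈ ε = inj₁ refl
    Star⇒≡⊎Via all∈ (r ◅ s) with Star⇒≡⊎Via all∈ s
    ... | inj₁ refl = inj₂ (hop r)
    ... | inj₂ p    = inj₂ (r ◅⟨ all∈ _ ⟩ p)

    module _ (R? : ∀ x y → Dec (R x y)) where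

      -- Floyd–Warshall: admit one more intermediate vertex at a time.
      via? : ∀ S x y → Dec (Via S x y)
      via? []      x y = map′ hop (λ { (hop r) → r }) (R? x y)
      via? (v ∷ S) x y = map′ Via-∷⁺ Via-∷⁻ (via? S x y ⊎-dec (via? S x v ×-dec via? S v y))

      star? : DecidableEquality V → ∀ {vs} → (∀ v → v ∈ vs) → ∀ x y → Dec (Star R x y)
      star? _≟_ {vs} all∈ x y = map′ ≡⊎Via⇒Star (Star⇒≡⊎Via all∈) (x ≟ y ⊎-dec via? vs x y)

module Arithmetic where

  open import Data.Nat
  open import Data.Nat.Properties
  open import Data.Nat.Solver using (module +-*-Solver)
  open import Relation.Binary.PropositionalEquality
  open import Algebra.Properties.CommutativeSemigroup *-commutativeSemigroup
    using () renaming (interchange to *-interchange)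

  ^-distribʳ-* : ∀ a b k → (a * b) ^ k ≡ a ^ k * b ^ k
  ^-distribʳ-* a b zero    = refl
  ^-distribʳ-* a b (suc k) = trans (cong (a * b *_) (^-distribʳ-* a b k)) (*-interchange a b (a ^ k) (b ^ k))

  -- Bernoulli's inequality (1 + 1/a)^j ≥ 1 + j/a, cleared of denominators.
  bernoulli : ∀ a j → a ^ j * (a + j) ≤ a * suc a ^ j
  bernoulli a zero = ≤-reflexive (solve 1 (λ a → con 1 :* (a :+ con 0) := a :* con 1) refl a)
    where open +-*-Solver
  bernoulli a (suc j) = begin
    a * a ^ j * (a + suc j)
      ≡⟨ solve 3 (λ a p j → a :* p :* (a :+ (con 1 :+ j)) := p :* (a :* (con 1 :+ a) :+ a :* j)) refl a (a ^ j) j ⟩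
    a ^ j * (a * suc a + a * j)
      ≤⟨ *-monoʳ-≤ (a ^ j) (+-monoʳ-≤ (a * suc a) (*-monoˡ-≤ j (n≤1+n a))) ⟩
    a ^ j * (a * suc a + suc a * j)
      ≡⟨ solve 3 (λ a p j → p :* (a :* (con 1 :+ a) :+ (con 1 :+ a) :* j) := (con 1 :+ a) :* (p :* (a :+ j))) refl a (a ^ j) j ⟩
    suc a * (a ^ j * (a + j))
      ≤⟨ *-monoʳ-≤ (suc a) (bernoulli a j) ⟩
    suc a * (a * suc a ^ j)
      ≡⟨ solve 3 (λ a s p → s :* (a :* p) := a :* (s :* p)) refl a (suc a) (suc a ^ j) ⟩
    a * (suc a * suc a ^ j) ∎
    where open ≤-Reasoning
          open +-*-Solver

  -- (a/(a+1))^j ≤ a/(a+j), turning a geometric bound into a harmonic one.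
  geometric⇒harmonic : ∀ a j d T → d * suc a ^ j ≤ a ^ j * T → d * (a + j) ≤ a * T
  geometric⇒harmonic a j d T d*[1+a]^j≤a^j*T =
    *-cancelʳ-≤ (d * (a + j)) (a * T) (suc a ^ j) {{m^n≢0 (suc a) j}} (begin
      d * (a + j) * suc a ^ j ≡⟨ solve 3 (λ d s p → d :* s :* p := d :* p :* s) refl d (a + j) (suc a ^ j) ⟩
      d * suc a ^ j * (a + j) ≤⟨ *-monoˡ-≤ (a + j) d*[1+a]^j≤a^j*T ⟩
      a ^ j * T * (a + j)     ≡⟨ solve 3 (λ q t s → q :* t :* s := t :* (q :* s)) refl (a ^ j) T (a + j) ⟩
      T * (a ^ j * (a + j))   ≤⟨ *-monoʳ-≤ T (bernoulli a j) ⟩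
      T * (a * suc a ^ j)     ≡⟨ solve 3 (λ t a p → t :* (a :* p) := a :* t :* p) refl T a (suc a ^ j) ⟩
      a * T * suc a ^ j       ∎)
    where open ≤-Reasoning
          open +-*-Solver

  half-< : ∀ {x T} → 0 < T → 2 * x ≤ T → x < T
  half-< {x} {T} 0<T 2x≤T = *-cancelˡ-< 2 x T (begin-strict
    2 * x       ≤⟨ 2x≤T ⟩
    T           <⟨ m<m+n T 0<T ⟩
    T + T       ≡⟨ cong (T +_) (+-identityʳ T) ⟨
    2 * T       ∎)
    where open ≤-Reasoning

module Counting where

  open import Data.Bool using (true; false; if_then_else_)
  open import Data.Fin using (Fin; zero; suc; toℕ)
  open import Data.List using (List; []; _∷_; _++_; map; filter; length; cartesianProductWith)
  import Data.List.Relation.Unary.All as All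
  import Data.List.Relation.Unary.AllPairs as AllPairs
  open import Data.List.Membership.Propositional using (_∈_)
  open import Data.List.Membership.Propositional.Properties using (∈-cartesianProductWith⁺)
  open import Data.List.Relation.Unary.Any using (here)
  open import Data.List.Relation.Unary.Unique.Propositional using (Unique)
  open import Data.List.Relation.Unary.Unique.Propositional.Properties using (cartesianProductWith⁺)
  open import Data.Nat using (ℕ; zero; suc; _+_; _*_; _^_; _≤_; _<_; z≤n; s≤s)
  open import Data.Nat.Properties
  open import Data.Nat.Solver using (module +-*-Solver)
  open import Data.Vec using (Vec; []; _∷_; lookup)
  open import Data.Vec.Properties using (∷-injective)
  open import Function using (_∘_)
  open import Relation.Nullary using (Dec; does; yes; no; ¬_; ¬?; contradiction)
  open import Relation.Nullary.Decidable using (_×-dec_)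
  open import Relation.Unary using (Pred; Decidable)
  open import Relation.Binary.PropositionalEquality
  open import Algebra.Properties.CommutativeSemigroup +-commutativeSemigroup
    using () renaming (interchange to +-interchange)

  private variable A B C : Set

  ∑ : List A → (A → ℕ) → ℕ
  ∑ []       f = 0
  ∑ (x ∷ xs) f = f x + ∑ xs f

  syntax ∑ xs (λ x → e) = ∑[ x ∈ xs ] e

  ∑-cong : ∀ (xs : List A) {f g} → (∀ x → f x ≡ g x) → ∑ xs f ≡ ∑ xs g
  ∑-cong []       f≗g = refl
  ∑-cong (x ∷ xs) f≗g = cong₂ _+_ (f≗g x) (∑-cong xs f≗g)

  ∑-mono-≤ : ∀ (xs : List A) {f g} → (∀ x → f x ≤ g x) → ∑ xs f ≤ ∑ xs g
  ∑-mono-≤ []       f≤g = z≤n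
  ∑-mono-≤ (x ∷ xs) f≤g = +-mono-≤ (f≤g x) (∑-mono-≤ xs f≤g)

  ∑-const : ∀ (xs : List A) c → ∑[ _ ∈ xs ] c ≡ length xs * c
  ∑-const []       c = refl
  ∑-const (x ∷ xs) c = cong (c +_) (∑-const xs c)

  ∑-+ : ∀ (xs : List A) f g → ∑[ x ∈ xs ] (f x + g x) ≡ ∑ xs f + ∑ xs g
  ∑-+ []       f g = refl
  ∑-+ (x ∷ xs) f g = trans (cong (f x + g x +_) (∑-+ xs f g)) (+-interchange (f x) (g x) _ _)

  ∑-distribʳ : ∀ (xs : List A) f c → ∑[ x ∈ xs ] (f x * c) ≡ ∑ xs f * c
  ∑-distribʳ []       f c = refl
  ∑-distribʳ (x ∷ xs) f c = trans (cong (f x * c +_) (∑-distribʳ xs f c)) (sym (*-distribʳ-+ c (f x) _))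

  ∑-distribˡ : ∀ (xs : List A) c f → ∑[ x ∈ xs ] (c * f x) ≡ c * ∑ xs f
  ∑-distribˡ xs c f = begin
    ∑[ x ∈ xs ] (c * f x) ≡⟨ ∑-cong xs (λ x → *-comm c (f x)) ⟩
    ∑[ x ∈ xs ] (f x * c) ≡⟨ ∑-distribʳ xs f c ⟩
    ∑ xs f * c            ≡⟨ *-comm _ c ⟩
    c * ∑ xs f            ∎
    where open ≡-Reasoning

  ∑-++ : ∀ (xs ys : List A) f → ∑ (xs ++ ys) f ≡ ∑ xs f + ∑ ys f
  ∑-++ []       ys f = refl
  ∑-++ (x ∷ xs) ys f = trans (cong (f x +_) (∑-++ xs ys f)) (sym (+-assoc (f x) _ _))

  ∑-map : ∀ (g : A → B) xs f → ∑ (map g xs) f ≡ ∑ xs (f ∘ g)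
  ∑-map g []       f = refl
  ∑-map g (x ∷ xs) f = cong (f (g x) +_) (∑-map g xs f)

  ∑-cartesianProductWith : ∀ (g : A → B → C) xs ys h →
    ∑ (cartesianProductWith g xs ys) h ≡ ∑[ x ∈ xs ] ∑[ y ∈ ys ] h (g x y)
  ∑-cartesianProductWith g []       ys h = refl
  ∑-cartesianProductWith g (x ∷ xs) ys h = begin
    ∑ (map (g x) ys ++ cartesianProductWith g xs ys) h
      ≡⟨ ∑-++ (map (g x) ys) _ h ⟩
    ∑ (map (g x) ys) h + ∑ (cartesianProductWith g xs ys) h
      ≡⟨ cong₂ _+_ (∑-map (g x) ys h) (∑-cartesianProductWith g xs ys h) ⟩
    ∑[ y ∈ ys ] h (g x y) + ∑[ x′ ∈ xs ] ∑[ y ∈ ys ] h (g x′ y) ∎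
    where open ≡-Reasoning

  length≡∑1 : ∀ (xs : List A) → length xs ≡ ∑[ _ ∈ xs ] 1
  length≡∑1 xs = sym (trans (∑-const xs 1) (*-identityʳ _))

  ∑≤length : ∀ (xs : List A) f → (∀ x → f x ≤ 1) → ∑ xs f ≤ length xs
  ∑≤length xs f f≤1 = ≤-trans (∑-mono-≤ xs f≤1) (≤-reflexive (sym (length≡∑1 xs)))

  𝟙 : {P : Set} → Dec P → ℕ
  𝟙 P? = if does P? then 1 else 0

  𝟙≤1 : {P : Set} (P? : Dec P) → 𝟙 P? ≤ 1
  𝟙≤1 P? with does P?
  ... | false = z≤n
  ... | true  = ≤-refl

  1≤𝟙 : {P : Set} (P? : Dec P) → P → 1 ≤ 𝟙 P?
  1≤𝟙 (yes _) _ = ≤-refl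
  1≤𝟙 (no ¬p) p = contradiction p ¬p

  𝟙-¬?-×-yes : {P Q : Set} (P? : Dec P) (Q? : Dec Q) → P → 𝟙 (¬? (P? ×-dec Q?)) ≡ 𝟙 (¬? Q?)
  𝟙-¬?-×-yes (yes _) Q? _ = refl
  𝟙-¬?-×-yes (no ¬p) Q? p = contradiction p ¬p

  𝟙-mono-≤ : {P Q : Set} (P? : Dec P) (Q? : Dec Q) → (P → Q) → 𝟙 P? ≤ 𝟙 Q?
  𝟙-mono-≤ (yes p) Q? P⇒Q = 1≤𝟙 Q? (P⇒Q p)
  𝟙-mono-≤ (no _)  Q? P⇒Q = z≤n

  𝟙≤𝟙+ : {P Q : Set} (P? : Dec P) (Q? : Dec Q) {k : ℕ} → (P → ¬ Q → 1 ≤ k) → 𝟙 P? ≤ 𝟙 Q? + k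
  𝟙≤𝟙+ (no _)  Q?      _   = z≤n
  𝟙≤𝟙+ (yes p) (yes _) _   = s≤s z≤n
  𝟙≤𝟙+ (yes p) (no ¬q) 1≤k = 1≤k p ¬q

  length-filter : ∀ {P : Pred A _} (P? : Decidable P) xs → length (filter P? xs) ≡ ∑[ x ∈ xs ] 𝟙 (P? x)
  length-filter P? [] = refl
  length-filter P? (x ∷ xs) with does (P? x)
  ... | true  = cong suc (length-filter P? xs)
  ... | false = length-filter P? xs

  allVec : List A → (n : ℕ) → List (Vec A n)
  allVec xs zero    = [] ∷ []
  allVec xs (suc n) = cartesianProductWith _∷_ xs (allVec xs n)

  ∈-allVec : ∀ {xs : List A} → (∀ x → x ∈ xs) → ∀ {n} (v : Vec A n) → v ∈ allVec xs n
  ∈-allVec all∈ []      = here refl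
  ∈-allVec all∈ (x ∷ v) = ∈-cartesianProductWith⁺ _∷_ (all∈ x) (∈-allVec all∈ v)

  allVec-unique : ∀ {xs : List A} → Unique xs → ∀ n → Unique (allVec xs n)
  allVec-unique u zero    = All.[] AllPairs.∷ AllPairs.[]
  allVec-unique u (suc n) = cartesianProductWith⁺ _∷_ ∷-injective u (allVec-unique u n)

  length-allVec : ∀ (xs : List A) n → length (allVec xs n) ≡ length xs ^ n
  length-allVec xs zero    = refl
  length-allVec xs (suc n) = begin
    length (allVec xs (suc n))         ≡⟨ length≡∑1 (allVec xs (suc n)) ⟩
    ∑[ _ ∈ allVec xs (suc n) ] 1       ≡⟨ ∑-cartesianProductWith _∷_ xs (allVec xs n) _ ⟩
    ∑[ _ ∈ xs ] ∑[ _ ∈ allVec xs n ] 1 ≡⟨ ∑-cong xs (λ _ → sym (length≡∑1 (allVec xs n))) ⟩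
    ∑[ _ ∈ xs ] length (allVec xs n)   ≡⟨ ∑-const xs _ ⟩
    length xs * length (allVec xs n)   ≡⟨ cong (length xs *_) (length-allVec xs n) ⟩
    length xs * length xs ^ n          ∎
    where open ≡-Reasoning

  ∑-allVec-tail : ∀ (xs : List A) k (f : Vec A (suc k) → ℕ) (g : Vec A k → ℕ) →
    (∀ x v → f (x ∷ v) ≡ g v) → ∑ (allVec xs (suc k)) f ≡ length xs * ∑ (allVec xs k) g
  ∑-allVec-tail xs k f g f∷≗g = begin
    ∑ (allVec xs (suc k)) f                    ≡⟨ ∑-cartesianProductWith _∷_ xs (allVec xs k) f ⟩
    ∑[ x ∈ xs ] ∑[ v ∈ allVec xs k ] f (x ∷ v) ≡⟨ ∑-cong xs (λ x → ∑-cong (allVec xs k) (f∷≗g x)) ⟩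
    ∑[ _ ∈ xs ] ∑ (allVec xs k) g              ≡⟨ ∑-const xs _ ⟩
    length xs * ∑ (allVec xs k) g              ∎
    where open ≡-Reasoning

  -- Both sides carry an extra factor |xs|, to avoid writing |xs| ^ (k ∸ 1).
  ∑-allVec-lookup : ∀ (xs : List A) k (i : Fin k) (ψ : A → ℕ) →
    ∑[ v ∈ allVec xs k ] ψ (lookup v i) * length xs ≡ ∑ xs ψ * length xs ^ k
  ∑-allVec-lookup xs (suc k) zero ψ = begin
    ∑[ v ∈ allVec xs (suc k) ] ψ (lookup v zero) * L
      ≡⟨ cong (_* L) (∑-cartesianProductWith _∷_ xs (allVec xs k) _) ⟩
    ∑[ x ∈ xs ] ∑[ _ ∈ allVec xs k ] ψ x * L
      ≡⟨ cong (_* L) (∑-cong xs (λ x → ∑-const (allVec xs k) (ψ x))) ⟩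
    ∑[ x ∈ xs ] (length (allVec xs k) * ψ x) * L
      ≡⟨ cong (_* L) (∑-distribˡ xs (length (allVec xs k)) ψ) ⟩
    length (allVec xs k) * ∑ xs ψ * L
      ≡⟨ cong (λ z → z * ∑ xs ψ * L) (length-allVec xs k) ⟩
    L ^ k * ∑ xs ψ * L
      ≡⟨ solve 3 (λ p s l → p :* s :* l := s :* (l :* p)) refl (L ^ k) (∑ xs ψ) L ⟩
    ∑ xs ψ * (L * L ^ k) ∎
    where open ≡-Reasoning
          open +-*-Solver
          L = length xs
  ∑-allVec-lookup xs (suc k) (suc i) ψ = begin
    ∑[ v ∈ allVec xs (suc k) ] ψ (lookup v (suc i)) * L
      ≡⟨ cong (_* L) (∑-allVec-tail xs k _ (λ v → ψ (lookup v i)) (λ _ _ → refl)) ⟩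
    L * S * L            ≡⟨ *-assoc L S L ⟩
    L * (S * L)          ≡⟨ cong (L *_) (∑-allVec-lookup xs k i ψ) ⟩
    L * (∑ xs ψ * L ^ k) ≡⟨ solve 3 (λ l s p → l :* (s :* p) := s :* (l :* p)) refl L (∑ xs ψ) (L ^ k) ⟩
    ∑ xs ψ * (L * L ^ k) ∎
    where open ≡-Reasoning
          open +-*-Solver
          L = length xs
          S = ∑[ v ∈ allVec xs k ] ψ (lookup v i)

  ∑-allVec-lookup₂ : ∀ (xs : List A) k (i : Fin k) (ψ : A → A → ℕ) →
    ∑[ v ∈ allVec xs (suc k) ] ψ (lookup v zero) (lookup v (suc i)) * length xs
      ≡ ∑[ x ∈ xs ] ∑[ y ∈ xs ] ψ x y * length xs ^ k
  ∑-allVec-lookup₂ xs k i ψ = begin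
    ∑[ v ∈ allVec xs (suc k) ] ψ (lookup v zero) (lookup v (suc i)) * L
      ≡⟨ cong (_* L) (∑-cartesianProductWith _∷_ xs (allVec xs k) _) ⟩
    ∑[ x ∈ xs ] ∑[ v ∈ allVec xs k ] ψ x (lookup v i) * L
      ≡⟨ ∑-distribʳ xs _ L ⟨
    ∑[ x ∈ xs ] (∑[ v ∈ allVec xs k ] ψ x (lookup v i) * L)
      ≡⟨ ∑-cong xs (λ x → ∑-allVec-lookup xs k i (ψ x)) ⟩
    ∑[ x ∈ xs ] (∑[ y ∈ xs ] ψ x y * L ^ k)
      ≡⟨ ∑-distribʳ xs _ (L ^ k) ⟩
    ∑[ x ∈ xs ] ∑[ y ∈ xs ] ψ x y * L ^ k ∎
    where open ≡-Reasoning
          L = length xs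

  ∏ : ∀ {k} → (Fin k → ℕ) → ℕ
  ∏ {zero}  g = 1
  ∏ {suc k} g = g zero * ∏ (g ∘ suc)

  -- Independence of the coordinates of a uniformly random vector.
  ∑-allVec-∏ : ∀ {A : Set} (xs : List A) k (f : Fin k → A → ℕ) →
    ∑[ v ∈ allVec xs k ] ∏ (λ i → f i (lookup v i)) ≡ ∏ (λ i → ∑ xs (f i))
  ∑-allVec-∏ xs zero    f = refl
  ∑-allVec-∏ {A} xs (suc k) f = begin
    ∑[ v ∈ allVec xs (suc k) ] ∏ (λ i → f i (lookup v i))
      ≡⟨ ∑-cartesianProductWith _∷_ xs (allVec xs k) _ ⟩
    ∑[ x ∈ xs ] ∑[ v ∈ allVec xs k ] (f zero x * Π v)
      ≡⟨ ∑-cong xs (λ x → ∑-distribˡ (allVec xs k) (f zero x) Π) ⟩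
    ∑[ x ∈ xs ] (f zero x * ∑ (allVec xs k) Π)
      ≡⟨ ∑-distribʳ xs (f zero) _ ⟩
    ∑ xs (f zero) * ∑ (allVec xs k) Π
      ≡⟨ cong (∑ xs (f zero) *_) (∑-allVec-∏ xs k (f ∘ suc)) ⟩
    ∑ xs (f zero) * ∏ (λ i → ∑ xs (f (suc i))) ∎
    where open ≡-Reasoning
          Π : Vec A k → ℕ
          Π v = ∏ (λ i → f (suc i) (lookup v i))

  1≤∏ : ∀ {k} {g : Fin k → ℕ} → (∀ i → 1 ≤ g i) → 1 ≤ ∏ g
  1≤∏ {zero}  _   = ≤-refl
  1≤∏ {suc k} 1≤g = *-mono-≤ (1≤g zero) (1≤∏ (1≤g ∘ suc))

  ∏-mono-≤ : ∀ {k} {g h : Fin k → ℕ} → (∀ i → g i ≤ h i) → ∏ g ≤ ∏ h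
  ∏-mono-≤ {zero}  g≤h = ≤-refl
  ∏-mono-≤ {suc k} g≤h = *-mono-≤ (g≤h zero) (∏-mono-≤ (g≤h ∘ suc))

  ∏-const : ∀ k B → ∏ {k} (λ _ → B) ≡ B ^ k
  ∏-const zero    B = refl
  ∏-const (suc k) B = cong (B *_) (∏-const k B)

  ∏-≤-scaled : ∀ {k} (g : Fin k → ℕ) {a b B} c → c ≤ k → (∀ i → g i ≤ B) →
    (∀ i → toℕ i < c → b * g i ≤ a * B) → ∏ g * b ^ c ≤ a ^ c * B ^ k
  ∏-≤-scaled {k} g {B = B} zero _ g≤B _ = begin
    ∏ g * 1         ≡⟨ *-identityʳ _ ⟩
    ∏ g             ≤⟨ ∏-mono-≤ g≤B ⟩
    ∏ {k} (λ _ → B) ≡⟨ ∏-const k B ⟩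
    B ^ k           ≡⟨ +-identityʳ _ ⟨
    1 * B ^ k       ∎
    where open ≤-Reasoning
  ∏-≤-scaled {suc k} g {a} {b} {B} (suc c) (s≤s c≤k) g≤B bg≤aB = begin
    g zero * P * (b * b ^ c)
      ≡⟨ solve 4 (λ x p y z → x :* p :* (y :* z) := (y :* x) :* (p :* z)) refl (g zero) P b (b ^ c) ⟩
    b * g zero * (P * b ^ c)
      ≤⟨ *-mono-≤ (bg≤aB zero (s≤s z≤n)) tail-bound ⟩
    a * B * (a ^ c * B ^ k)
      ≡⟨ solve 4 (λ x y z w → x :* y :* (z :* w) := x :* z :* (y :* w)) refl a B (a ^ c) (B ^ k) ⟩
    a * a ^ c * (B * B ^ k) ∎
    where open ≤-Reasoning
          open +-*-Solver
          P = ∏ (g ∘ suc)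
          tail-bound : P * b ^ c ≤ a ^ c * B ^ k
          tail-bound = ∏-≤-scaled (g ∘ suc) c c≤k (g≤B ∘ suc) (λ i i<c → bg≤aB (suc i) (s≤s i<c))

module Fractions where

  open import Data.Integer as ℤ using (+_; -[1+_]; +<+)
  import Data.Integer.Properties as ℤ
  open import Data.Nat as ℕ using (ℕ; suc; NonZero)
  import Data.Nat.Properties as ℕ
  open import Data.Nat.Solver using (module +-*-Solver)
  open import Data.Product using (∃; _,_)
  open import Data.Rational using (mkℚ; *<*; 0ℚ; _<_; _+_; _-_; -_; ∣_∣; _/_; toℚᵘ)
  import Data.Rational.Properties as ℚ
  open import Data.Rational.Unnormalised as ℚᵘ using (mkℚᵘ; _≃_)
  import Data.Rational.Unnormalised.Properties as ℚᵘ
  open import Algebra.Properties.AbelianGroup ℚ.+-0-abelianGroup using (xyx⁻¹≈y; ⁻¹-anti-homo‿-)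
  open import Data.Sum using (inj₁; inj₂)
  open import Relation.Binary.PropositionalEquality

  positive-as-fraction : ∀ ε → 0ℚ < ε → ∃ λ p → ∃ λ q → ε ≡ + suc p / suc q
  positive-as-fraction (mkℚ (+ suc p)  q _) _ = p , q , sym (ℚ.↥p/↧p≡p _)
  positive-as-fraction (mkℚ (+ 0)      q _) (*<* (+<+ ()))
  positive-as-fraction (mkℚ -[1+ _ ]   q _) (*<* ())

  x<y+ε⇒x-y<ε : ∀ {x y ε} → x < y + ε → x - y < ε
  x<y+ε⇒x-y<ε {x} {y} {ε} x<y+ε = subst (x - y <_) (xyx⁻¹≈y y ε) (ℚ.+-monoˡ-< (- y) x<y+ε)

  ∣x-y∣<ε : ∀ {x y ε} → x < y + ε → y < x + ε → ∣ x - y ∣ < ε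
  ∣x-y∣<ε {x} {y} x<y+ε y<x+ε with ℚ.∣p∣≡p∨∣p∣≡-p (x - y)
  ... | inj₁ ∣x-y∣≡x-y  = subst (_< _) (sym ∣x-y∣≡x-y) (x<y+ε⇒x-y<ε x<y+ε)
  ... | inj₂ ∣x-y∣≡-x-y = subst (_< _) (sym (trans ∣x-y∣≡-x-y (⁻¹-anti-homo‿- x y))) (x<y+ε⇒x-y<ε y<x+ε)

  toℚᵘ-/ : ∀ i n .{{_ : NonZero n}} → toℚᵘ (i / n) ≃ i ℚᵘ./ n
  toℚᵘ-/ i (suc n) = ℚ.toℚᵘ-fromℚᵘ (mkℚᵘ i n)

  /</+/ : ∀ a b c d e f .{{_ : NonZero b}} .{{_ : NonZero d}} .{{_ : NonZero f}} →
    a ℕ.* (d ℕ.* f) ℕ.< (c ℕ.* f ℕ.+ e ℕ.* d) ℕ.* b → + a / b < + c / d + + e / f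
  /</+/ a b@(suc _) c d@(suc _) e f@(suc _) cross = ℚ.toℚᵘ-cancel-< (begin-strict
    toℚᵘ (+ a / b)                     ≃⟨ toℚᵘ-/ (+ a) b ⟩
    + a ℚᵘ./ b                         <⟨ ℚᵘ.*<* (subst₂ ℤ._<_ (sym lhs) (sym rhs) (+<+ cross)) ⟩
    + c ℚᵘ./ d ℚᵘ.+ + e ℚᵘ./ f         ≃⟨ ℚᵘ.+-cong (toℚᵘ-/ (+ c) d) (toℚᵘ-/ (+ e) f) ⟨
    toℚᵘ (+ c / d) ℚᵘ.+ toℚᵘ (+ e / f) ≃⟨ ℚ.toℚᵘ-homo-+ (+ c / d) (+ e / f) ⟨
    toℚᵘ (+ c / d + + e / f)           ∎)
    where
    open ℚᵘ.≤-Reasoning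
    lhs : + a ℤ.* + (d ℕ.* f) ≡ + (a ℕ.* (d ℕ.* f))
    lhs = sym (ℤ.pos-* a (d ℕ.* f))
    rhs : (+ c ℤ.* + f ℤ.+ + e ℤ.* + d) ℤ.* + b ≡ + ((c ℕ.* f ℕ.+ e ℕ.* d) ℕ.* b)
    rhs = sym (trans (ℤ.pos-* (c ℕ.* f ℕ.+ e ℕ.* d) b)
                     (cong (ℤ._* + b) (trans (ℤ.pos-+ (c ℕ.* f) (e ℕ.* d)) (cong₂ ℤ._+_ (ℤ.pos-* c f) (ℤ.pos-* e d)))))

  -- The hypotheses say c/T ≤ a/b ≤ (c+d)/T and d/T < P/Q.
  ∣c/T-a/b∣<P/Q : ∀ c d T a b P Q .{{_ : NonZero T}} .{{_ : NonZero b}} .{{_ : NonZero Q}} →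
    b ℕ.* c ℕ.≤ a ℕ.* T → a ℕ.* T ℕ.≤ b ℕ.* (c ℕ.+ d) → d ℕ.* Q ℕ.< P ℕ.* T →
    ∣ + c / T - + a / b ∣ < + P / Q
  ∣c/T-a/b∣<P/Q c d T a b P Q bc≤aT aT≤b[c+d] dQ<PT =
    ∣x-y∣<ε (/</+/ c T a b P Q below) (/</+/ a b c T P Q above)
    where
    open ℕ.≤-Reasoning
    open +-*-Solver
    below : c ℕ.* (b ℕ.* Q) ℕ.< (a ℕ.* Q ℕ.+ P ℕ.* b) ℕ.* T
    below = begin-strict
      c ℕ.* (b ℕ.* Q)
        ≡⟨ solve 3 (λ c b q → c :* (b :* q) := b :* c :* q) refl c b Q ⟩
      b ℕ.* c ℕ.* Q
        ≤⟨ ℕ.*-monoˡ-≤ Q bc≤aT ⟩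
      a ℕ.* T ℕ.* Q
        <⟨ ℕ.m<m+n _ (ℕ.*-mono-< (ℕ.>-nonZero⁻¹ b) (ℕ.≤-<-trans ℕ.z≤n dQ<PT)) ⟩
      a ℕ.* T ℕ.* Q ℕ.+ b ℕ.* (P ℕ.* T)
        ≡⟨ solve 5 (λ a t q b p → a :* t :* q :+ b :* (p :* t) := (a :* q :+ p :* b) :* t) refl a T Q b P ⟩
      (a ℕ.* Q ℕ.+ P ℕ.* b) ℕ.* T ∎
    above : a ℕ.* (T ℕ.* Q) ℕ.< (c ℕ.* Q ℕ.+ P ℕ.* T) ℕ.* b
    above = begin-strict
      a ℕ.* (T ℕ.* Q)
        ≡⟨ ℕ.*-assoc a T Q ⟨
      a ℕ.* T ℕ.* Q
        ≤⟨ ℕ.*-monoˡ-≤ Q aT≤b[c+d] ⟩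
      b ℕ.* (c ℕ.+ d) ℕ.* Q
        ≡⟨ solve 4 (λ b c d q → b :* (c :+ d) :* q := b :* (c :* q) :+ b :* (d :* q)) refl b c d Q ⟩
      b ℕ.* (c ℕ.* Q) ℕ.+ b ℕ.* (d ℕ.* Q)
        <⟨ ℕ.+-monoʳ-< (b ℕ.* (c ℕ.* Q)) (ℕ.*-monoʳ-< b dQ<PT) ⟩
      b ℕ.* (c ℕ.* Q) ℕ.+ b ℕ.* (P ℕ.* T)
        ≡⟨ solve 5 (λ b c q p t → b :* (c :* q) :+ b :* (p :* t) := (c :* q :+ p :* t) :* b) refl b c Q P T ⟩
      (c ℕ.* Q ℕ.+ P ℕ.* T) ℕ.* b ∎

module Directions where

  open import Defs using (Dir; N; NE; E; SE; S; SW; W; NW)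
  open Counting using (∑; 𝟙)
  open import Data.Fin as Fin using (Fin; #_)
  open import Data.List using (List; map; allFin)
  open import Data.List.Membership.Propositional using (_∈_)
  open import Data.List.Membership.Propositional.Properties using (∈-map⁺; ∈-allFin)
  open import Data.List.Relation.Unary.Unique.Propositional using (Unique)
  open import Data.Vec using (Vec; []; _∷_; lookup)
  open import Relation.Binary.Definitions using (DecidableEquality)
  open import Relation.Binary.PropositionalEquality
  open import Relation.Nullary using (¬?)
  open import Relation.Nullary.Decidable using (map′; _×-dec_; from-yes)

  dirs : Vec Dir 8
  dirs = N ∷ NE ∷ E ∷ SE ∷ S ∷ SW ∷ W ∷ NW ∷ []

  index : Dir → Fin 8
  index N  = # 0
  index NE = # 1
  index E  = # 2
  index SE = # 3
  index S  = # 4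
  index SW = # 5
  index W  = # 6
  index NW = # 7

  lookup-index : ∀ d → lookup dirs (index d) ≡ d
  lookup-index N  = refl
  lookup-index NE = refl
  lookup-index E  = refl
  lookup-index SE = refl
  lookup-index S  = refl
  lookup-index SW = refl
  lookup-index W  = refl
  lookup-index NW = refl

  index-injective : ∀ {d d′} → index d ≡ index d′ → d ≡ d′
  index-injective {d} {d′} eq = trans (sym (lookup-index d)) (trans (cong (lookup dirs) eq) (lookup-index d′))

  _≟_ : DecidableEquality Dir
  d ≟ d′ = map′ index-injective (cong index) (index d Fin.≟ index d′)

  allDir : List Dir
  allDir = map (lookup dirs) (allFin 8)

  ∈-allDir : ∀ d → d ∈ allDir
  ∈-allDir d = subst (_∈ allDir) (lookup-index d) (∈-map⁺ (lookup dirs) (∈-allFin (index d)))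

  allDir-unique : Unique allDir
  allDir-unique = from-yes (unique? allDir)
    where open import Data.List.Relation.Unary.Unique.DecPropositional _≟_ using (unique?)

  avoid-count : ∀ t → ∑[ x ∈ allDir ] ∑[ y ∈ allDir ] 𝟙 (¬? (x ≟ t ×-dec y ≟ SE)) ≡ 63
  avoid-count N  = refl
  avoid-count NE = refl
  avoid-count E  = refl
  avoid-count SE = refl
  avoid-count S  = refl
  avoid-count SW = refl
  avoid-count W  = refl
  avoid-count NW = refl

module Boards where

  open import Defs
  open Reachability using (star?)
  open Counting using (allVec; ∈-allVec; allVec-unique; length-allVec)
  open Directions using (allDir; ∈-allDir; allDir-unique)
  open import Data.Fin using (Fin; zero; suc; toℕ)
  import Data.Fin.Properties as Fin
  open import Data.List using (List; []; _∷_; filter; length; cartesianProduct; allFin)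
  open import Data.List.Membership.Propositional using (_∈_)
  open import Data.List.Membership.Propositional.Properties using (∈-allFin; ∈-cartesianProduct⁺; ∈-filter⁺; ∈-filter⁻)
  open import Data.List.Relation.Unary.Any using (here; there)
  open import Data.List.Relation.Unary.Unique.Propositional using (Unique)
  open import Data.List.Relation.Unary.Unique.Propositional.Properties using (filter⁺)
  open import Data.Nat as ℕ using (suc; _+_; _∸_; _^_; _<?_; s≤s)
  import Data.Nat.Properties as ℕ
  open import Data.Product using (_,_; proj₂)
  open import Data.Product.Properties using (≡-dec)
  open import Data.Vec using (Vec; lookup)
  open import Function using (_∘_)
  open import Function.Bundles using (_⇔_; mk⇔)
  open import Relation.Binary.PropositionalEquality using (_≡_; refl)
  open import Relation.Binary.Construct.Closure.ReflexiveTransitive using (_◅_)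
  open import Relation.Nullary using (Dec)
  open import Relation.Nullary.Decidable using (_×-dec_)

  directing? : ∀ {n} d (p q : Pos n) → Dec (Directing d p q)
  directing? N  (i , j) (i′ , j′) = toℕ j′ ℕ.≟ toℕ j ×-dec toℕ i′ <? toℕ i
  directing? NE (i , j) (i′ , j′) = toℕ i′ <? toℕ i ×-dec toℕ j <? toℕ j′ ×-dec toℕ i ∸ toℕ i′ ℕ.≟ toℕ j′ ∸ toℕ j
  directing? E  (i , j) (i′ , j′) = toℕ i′ ℕ.≟ toℕ i ×-dec toℕ j <? toℕ j′
  directing? SE (i , j) (i′ , j′) = toℕ i <? toℕ i′ ×-dec toℕ j <? toℕ j′ ×-dec toℕ i′ ∸ toℕ i ℕ.≟ toℕ j′ ∸ toℕ j
  directing? S  (i , j) (i′ , j′) = toℕ j′ ℕ.≟ toℕ j ×-dec toℕ i <? toℕ i′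
  directing? SW (i , j) (i′ , j′) = toℕ i <? toℕ i′ ×-dec toℕ j′ <? toℕ j ×-dec toℕ i′ ∸ toℕ i ℕ.≟ toℕ j ∸ toℕ j′
  directing? W  (i , j) (i′ , j′) = toℕ i′ ℕ.≟ toℕ i ×-dec toℕ j′ <? toℕ j
  directing? NW (i , j) (i′ , j′) = toℕ i′ <? toℕ i ×-dec toℕ j′ <? toℕ j ×-dec toℕ i ∸ toℕ i′ ℕ.≟ toℕ j ∸ toℕ j′

  move? : ∀ {n} (A : Board n) p q → Dec (Move A p q)
  move? A (i , j) = directing? (lookup (lookup A i) j) (i , j)

  allPos : ∀ n → List (Pos n)
  allPos n = cartesianProduct (allFin n) (allFin n)

  ∈-allPos : ∀ {n} (p : Pos n) → p ∈ allPos n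
  ∈-allPos (i , j) = ∈-cartesianProduct⁺ (∈-allFin i) (∈-allFin j)

  solvable? : ∀ m (A : Board (oddSize m)) → Dec (Solvable m A)
  solvable? m A = star? (Move A) (move? A) (≡-dec Fin._≟_ Fin._≟_) ∈-allPos (start m) (centre m)

  rows : ∀ n → List (Vec Dir n)
  rows n = allVec allDir n

  boards : ∀ n → List (Board n)
  boards n = allVec (rows n) n

  length-rows : ∀ n → length (rows n) ≡ 8 ^ n
  length-rows = length-allVec allDir

  solvableBoards : ∀ m → List (Board (oddSize m))
  solvableBoards m = filter (solvable? m) (boards (oddSize m))

  solvableBoards-unique : ∀ m → Unique (solvableBoards m)
  solvableBoards-unique m = filter⁺ (solvable? m) (allVec-unique (allVec-unique allDir-unique _) _)

  ∈-solvableBoards⇔ : ∀ m (A : Board (oddSize m)) → A ∈ solvableBoards m ⇔ Solvable m A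
  ∈-solvableBoards⇔ m A = mk⇔ (proj₂ ∘ ∈-filter⁻ (solvable? m) {xs = boards (oddSize m)})
                               (∈-filter⁺ (solvable? m) (∈-allVec (∈-allVec ∈-allDir) A))

  centre-toℕ : ∀ m → toℕ (centreIdx m) ≡ m
  centre-toℕ m = Fin.toℕ-fromℕ< (s≤s (ℕ.m≤m+n m (m + 0)))

  corner : ∀ {n} → Board (suc n) → Dir
  corner A = lookup (lookup A zero) zero

  exits : List Dir
  exits = E ∷ SE ∷ S ∷ []

  exit-from-corner : ∀ {n} d (q : Pos (suc n)) → Directing d (zero , zero) q → d ∈ exits
  exit-from-corner N  _ (_ , ())
  exit-from-corner NE _ (() , _)
  exit-from-corner E  _ _ = here refl
  exit-from-corner SE _ _ = there (here refl)
  exit-from-corner S  _ _ = there (there (here refl))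
  exit-from-corner SW _ (_ , () , _)
  exit-from-corner W  _ (_ , ())
  exit-from-corner NW _ (() , _)

  -- No clause for the empty path: for m = suc j the centre is not the corner.
  solvable⇒corner∈exits : ∀ j (A : Board (oddSize (suc j))) → Solvable (suc j) A → corner A ∈ exits
  solvable⇒corner∈exits j A (_◅_ {j = q} r _) = exit-from-corner (corner A) q r

open import Data.Nat using (ℕ)

module SolvableDensity (j : ℕ) where

  open import Defs
  open Arithmetic
  open Counting
  open Directions using (_≟_; allDir)
  open Boards
  open Fractions using (∣c/T-a/b∣<P/Q)
  open import Data.Integer using (+_)
  open import Data.Rational as ℚ using (_-_; ∣_∣; _/_)
  open import Data.Fin using (Fin; zero; suc; toℕ)
  open import Data.List using (length)
  open import Data.List.Membership.DecPropositional _≟_ using (_∈_; _∈?_)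
  open import Data.List.Relation.Unary.Any using (here; there)
  open import Data.Nat as ℕ using (ℕ; suc; _+_; _*_; _^_; _≤_; _<_; z≤n; s≤s; _<?_)
  import Data.Nat.Properties as ℕ
  open import Data.Nat.Solver using (module +-*-Solver)
  open import Data.Product using (_×_; _,_)
  open import Data.Vec using (Vec; _∷_; lookup)
  open import Relation.Binary.PropositionalEquality
  open import Relation.Binary.Construct.Closure.ReflexiveTransitive using (Star; ε; _◅_)
  open import Relation.Nullary using (Dec; ¬_; ¬?; contradiction)
  open import Relation.Nullary.Decidable using (_×-dec_)

  private
    m = suc j
    n = oddSize m

  move-by : (A : Board n) {i k : Fin n} {q : Pos n} {d : Dir} →
            lookup (lookup A i) k ≡ d → Directing d (i , k) q → Move A (i , k) q
  move-by A A[i,k]≡d = subst (λ d → Directing d _ _) (sym A[i,k]≡d)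

  -- An index i : Fin (2 * m) stands for row and column suc i; the routes below need toℕ i < j,
  -- i.e. suc i strictly above and left of the centre m.
  to-centre : (A : Board n) (i : Fin (2 * m)) → toℕ i < j →
              lookup (lookup A (suc i)) (suc i) ≡ SE → Star (Move A) (suc i , suc i) (centre m)
  to-centre A i i<j A[i,i]≡SE = move-by A A[i,i]≡SE (i<c , i<c , refl) ◅ ε
    where
    i<c : suc (toℕ i) < toℕ (centreIdx m)
    i<c = subst (suc (toℕ i) <_) (sym (centre-toℕ m)) (s≤s i<j)

  south-route : (A : Board n) (i : Fin (2 * m)) → toℕ i < j → corner A ≡ S →
                lookup (lookup A (suc i)) zero ≡ E → lookup (lookup A (suc i)) (suc i) ≡ SE → Solvable m A
  south-route A i i<j A[0,0]≡S A[i,0]≡E A[i,i]≡SE =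
    move-by A A[0,0]≡S (refl , s≤s z≤n) ◅ move-by A A[i,0]≡E (refl , s≤s z≤n) ◅ to-centre A i i<j A[i,i]≡SE

  east-route : (A : Board n) (i : Fin (2 * m)) → toℕ i < j → corner A ≡ E →
               lookup (lookup A zero) (suc i) ≡ S → lookup (lookup A (suc i)) (suc i) ≡ SE → Solvable m A
  east-route A i i<j A[0,0]≡E A[0,i]≡S A[i,i]≡SE =
    move-by A A[0,0]≡E (refl , s≤s z≤n) ◅ move-by A A[0,i]≡S (refl , s≤s z≤n) ◅ to-centre A i i<j A[i,i]≡SE

  diagonal-route : (A : Board n) → corner A ≡ SE → Solvable m A
  diagonal-route A A[0,0]≡SE = move-by A A[0,0]≡SE (0<c , 0<c , refl) ◅ ε
    where
    0<c : 0 < toℕ (centreIdx m)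
    0<c = subst (0 <_) (sym (centre-toℕ m)) (s≤s z≤n)

  Route : Fin (2 * m) → Dir → Dir → Dir → Set
  Route i t x y = toℕ i < j × x ≡ t × y ≡ SE

  route? : ∀ i t x y → Dec (Route i t x y)
  route? i t x y = toℕ i <? j ×-dec x ≟ t ×-dec y ≟ SE

  miss : Fin (2 * m) → Dir → Dir → Dir → ℕ
  miss i t x y = 𝟙 (¬? (route? i t x y))

  1≤miss : ∀ {i t x y} → ¬ Route i t x y → 1 ≤ miss i t x y
  1≤miss {i} {t} {x} {y} = 1≤𝟙 (¬? (route? i t x y))

  -- 1 if the board contains none of the south (resp. east) routes, 0 otherwise.
  southMisses : Board n → ℕ
  southMisses A = ∏ λ i → miss i E (lookup (lookup A (suc i)) zero) (lookup (lookup A (suc i)) (suc i))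

  eastMisses : Board n → ℕ
  eastMisses A = ∏ λ i → miss i S (lookup (lookup A zero) (suc i)) (lookup (lookup A (suc i)) (suc i))

  solvable≤corner : (A : Board n) → 𝟙 (solvable? m A) ≤ 𝟙 (corner A ∈? exits)
  solvable≤corner A = 𝟙-mono-≤ (solvable? m A) (corner A ∈? exits) (solvable⇒corner∈exits j A)

  unsolvable⇒misses : (A : Board n) → corner A ∈ exits → ¬ Solvable m A → 1 ≤ eastMisses A + southMisses A
  unsolvable⇒misses A (here c≡E) ¬s =
    ℕ.≤-trans (1≤∏ λ i → 1≤miss λ (i<j , e , e′) → ¬s (east-route A i i<j c≡E e e′)) (ℕ.m≤m+n _ _)
  unsolvable⇒misses A (there (here c≡SE)) ¬s = contradiction (diagonal-route A c≡SE) ¬s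
  unsolvable⇒misses A (there (there (here c≡S))) ¬s =
    ℕ.≤-trans (1≤∏ λ i → 1≤miss λ (i<j , e , e′) → ¬s (south-route A i i<j c≡S e e′)) (ℕ.m≤n+m _ _)

  corner≤solvable+misses : (A : Board n) →
    𝟙 (corner A ∈? exits) ≤ 𝟙 (solvable? m A) + (eastMisses A + southMisses A)
  corner≤solvable+misses A = 𝟙≤𝟙+ (corner A ∈? exits) (solvable? m A) (unsolvable⇒misses A)

  ∑∑-miss : ∀ i t → toℕ i < j → ∑[ x ∈ allDir ] ∑[ y ∈ allDir ] miss i t x y ≡ 63
  ∑∑-miss i t i<j = trans (∑-cong allDir λ x → ∑-cong allDir λ y → 𝟙-¬?-×-yes (toℕ i <? j) (x ≟ t ×-dec y ≟ SE) i<j)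
                          (Directions.avoid-count t)

  ∑-miss≤ : ∀ i t (x : Vec Dir n → Dir) → ∑[ row ∈ rows n ] miss i t (x row) (lookup row (suc i)) ≤ 8 ^ n
  ∑-miss≤ i t x = ℕ.≤-trans (∑≤length (rows n) (λ row → miss i t (x row) (lookup row (suc i)))
                                       λ row → 𝟙≤1 (¬? (route? i t (x row) (lookup row (suc i)))))
                            (ℕ.≤-reflexive (length-rows n))

  scale-by-8 : ∀ s b → s * 8 ≡ 63 * b → 64 * s ≤ 63 * (8 * b)
  scale-by-8 s b s*8≡63*b = ℕ.≤-reflexive (begin
    64 * s       ≡⟨ solve 1 (λ s → con 64 :* s := con 8 :* (s :* con 8)) refl s ⟩
    8 * (s * 8)  ≡⟨ cong (8 *_) s*8≡63*b ⟩
    8 * (63 * b) ≡⟨ solve 1 (λ b → con 8 :* (con 63 :* b) := con 63 :* (con 8 :* b)) refl b ⟩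
    63 * (8 * b) ∎)
    where open ≡-Reasoning
          open +-*-Solver

  southRowMisses : Fin (2 * m) → ℕ
  southRowMisses i = ∑[ row ∈ rows n ] miss i E (lookup row zero) (lookup row (suc i))

  ∑-southMisses : ∑ (boards n) southMisses ≡ 8 ^ n * ∏ southRowMisses
  ∑-southMisses = begin
    ∑ (boards n) southMisses
      ≡⟨ ∑-allVec-tail (rows n) (2 * m) southMisses _ (λ _ _ → refl) ⟩
    length (rows n) * ∑[ A ∈ allVec (rows n) (2 * m) ] ∏ (λ i → south-weight i (lookup A i))
      ≡⟨ cong₂ _*_ (length-rows n) (∑-allVec-∏ (rows n) (2 * m) south-weight) ⟩
    8 ^ n * ∏ southRowMisses ∎
    where
    open ≡-Reasoning
    south-weight : Fin (2 * m) → Vec Dir n → ℕ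
    south-weight i row = miss i E (lookup row zero) (lookup row (suc i))

  southRowMisses≤ : ∀ i → southRowMisses i ≤ 8 ^ n
  southRowMisses≤ i = ∑-miss≤ i E (λ row → lookup row zero)

  southRowMisses-scaled : ∀ i → toℕ i < j → 64 * southRowMisses i ≤ 63 * 8 ^ n
  southRowMisses-scaled i i<j = scale-by-8 (southRowMisses i) (8 ^ (2 * m))
    (trans (∑-allVec-lookup₂ allDir (2 * m) i (miss i E)) (cong (_* 8 ^ (2 * m)) (∑∑-miss i E i<j)))

  eastColumnMisses : Fin (2 * m) → ℕ
  eastColumnMisses i = ∑[ t ∈ allDir ] ∑[ row ∈ rows n ] miss i S t (lookup row (suc i))

  ∑-eastMisses : ∑ (boards n) eastMisses ≡ 8 * ∏ eastColumnMisses
  ∑-eastMisses = begin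
    ∑ (boards n) eastMisses
      ≡⟨ ∑-cartesianProductWith _∷_ (rows n) (allVec (rows n) (2 * m)) eastMisses ⟩
    ∑[ top ∈ rows n ] ∑[ rest ∈ allVec (rows n) (2 * m) ] ∏ (λ i → east-weight i (lookup top (suc i)) (lookup rest i))
      ≡⟨ ∑-cong (rows n) (λ top → ∑-allVec-∏ (rows n) (2 * m) (λ i → east-weight i (lookup top (suc i)))) ⟩
    ∑[ top ∈ rows n ] ∏ (λ i → column i (lookup top (suc i)))
      ≡⟨ ∑-allVec-tail allDir (2 * m) _ (λ v → ∏ λ i → column i (lookup v i)) (λ _ _ → refl) ⟩
    8 * ∑[ v ∈ allVec allDir (2 * m) ] ∏ (λ i → column i (lookup v i))
      ≡⟨ cong (8 *_) (∑-allVec-∏ allDir (2 * m) column) ⟩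
    8 * ∏ eastColumnMisses ∎
    where
    open ≡-Reasoning
    east-weight : Fin (2 * m) → Dir → Vec Dir n → ℕ
    east-weight i t row = miss i S t (lookup row (suc i))
    column : Fin (2 * m) → Dir → ℕ
    column i t = ∑[ row ∈ rows n ] east-weight i t row

  eastColumnMisses≤ : ∀ i → eastColumnMisses i ≤ 8 * 8 ^ n
  eastColumnMisses≤ i = ℕ.≤-trans (∑-mono-≤ allDir λ t → ∑-miss≤ i S (λ _ → t))
                                  (ℕ.≤-reflexive (∑-const allDir (8 ^ n)))

  eastColumnMisses-scaled : ∀ i → toℕ i < j → 64 * eastColumnMisses i ≤ 63 * (8 * 8 ^ n)
  eastColumnMisses-scaled i i<j = scale-by-8 (eastColumnMisses i) (8 ^ n) (begin
    ∑[ t ∈ allDir ] ∑[ row ∈ rows n ] miss i S t (lookup row (suc i)) * 8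
      ≡⟨ ∑-distribʳ allDir (λ t → ∑[ row ∈ rows n ] miss i S t (lookup row (suc i))) 8 ⟨
    ∑[ t ∈ allDir ] (∑[ row ∈ rows n ] miss i S t (lookup row (suc i)) * 8)
      ≡⟨ ∑-cong allDir (λ t → ∑-allVec-lookup allDir n (suc i) (miss i S t)) ⟩
    ∑[ t ∈ allDir ] (∑[ y ∈ allDir ] miss i S t y * 8 ^ n)
      ≡⟨ ∑-distribʳ allDir (λ t → ∑[ y ∈ allDir ] miss i S t y) (8 ^ n) ⟩
    ∑[ t ∈ allDir ] ∑[ y ∈ allDir ] miss i S t y * 8 ^ n
      ≡⟨ cong (_* 8 ^ n) (∑∑-miss i S i<j) ⟩
    63 * 8 ^ n ∎)
    where open ≡-Reasoning

  j≤2m : j ≤ 2 * m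
  j≤2m = ℕ.≤-trans (ℕ.n≤1+n j) (ℕ.m≤m+n m (m + 0))

  south-bound : ∑ (boards n) southMisses * 64 ^ j ≤ 63 ^ j * (8 ^ n) ^ n
  south-bound = begin
    ∑ (boards n) southMisses * 64 ^ j
      ≡⟨ cong (_* 64 ^ j) ∑-southMisses ⟩
    8 ^ n * ∏ southRowMisses * 64 ^ j
      ≡⟨ ℕ.*-assoc (8 ^ n) (∏ southRowMisses) (64 ^ j) ⟩
    8 ^ n * (∏ southRowMisses * 64 ^ j)
      ≤⟨ ℕ.*-monoʳ-≤ (8 ^ n) (∏-≤-scaled southRowMisses j j≤2m southRowMisses≤ southRowMisses-scaled) ⟩
    8 ^ n * (63 ^ j * (8 ^ n) ^ (2 * m))
      ≡⟨ solve 3 (λ r a p → r :* (a :* p) := a :* (r :* p)) refl (8 ^ n) (63 ^ j) ((8 ^ n) ^ (2 * m)) ⟩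
    63 ^ j * (8 ^ n) ^ n ∎
    where open ℕ.≤-Reasoning
          open +-*-Solver

  east-bound : ∑ (boards n) eastMisses * 64 ^ j ≤ 63 ^ j * (8 ^ n) ^ n
  east-bound = begin
    ∑ (boards n) eastMisses * 64 ^ j
      ≡⟨ cong (_* 64 ^ j) ∑-eastMisses ⟩
    8 * ∏ eastColumnMisses * 64 ^ j
      ≡⟨ ℕ.*-assoc 8 (∏ eastColumnMisses) (64 ^ j) ⟩
    8 * (∏ eastColumnMisses * 64 ^ j)
      ≤⟨ ℕ.*-monoʳ-≤ 8 (∏-≤-scaled eastColumnMisses j j≤2m eastColumnMisses≤ eastColumnMisses-scaled) ⟩
    8 * (63 ^ j * (8 * 8 ^ n) ^ (2 * m))
      ≡⟨ cong (λ z → 8 * (63 ^ j * z)) (^-distribʳ-* 8 (8 ^ n) (2 * m)) ⟩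
    8 * (63 ^ j * (8 ^ (2 * m) * (8 ^ n) ^ (2 * m)))
      ≡⟨ solve 3 (λ a b c → con 8 :* (a :* (b :* c)) := a :* (con 8 :* b :* c)) refl (63 ^ j) (8 ^ (2 * m)) ((8 ^ n) ^ (2 * m)) ⟩
    63 ^ j * (8 ^ n) ^ n ∎
    where open ℕ.≤-Reasoning
          open +-*-Solver

  ∑-corner : 8 * ∑[ A ∈ boards n ] 𝟙 (corner A ∈? exits) ≡ 3 * (8 ^ n) ^ n
  ∑-corner = ℕ.*-cancelʳ-≡ _ _ R {{ℕ.m^n≢0 8 n}} (begin
    8 * G * R                   ≡⟨ solve 2 (λ g r → con 8 :* g :* r := g :* r :* con 8) refl G R ⟩
    G * R * 8                   ≡⟨ cong (λ L → G * L * 8) (length-rows n) ⟨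
    G * length (rows n) * 8     ≡⟨ cong (_* 8) (∑-allVec-lookup (rows n) n zero (λ row → 𝟙 (lookup row zero ∈? exits))) ⟩
    C * length (rows n) ^ n * 8 ≡⟨ cong (λ L → C * L ^ n * 8) (length-rows n) ⟩
    C * R ^ n * 8               ≡⟨ solve 2 (λ c p → c :* p :* con 8 := c :* con 8 :* p) refl C (R ^ n) ⟩
    C * 8 * R ^ n               ≡⟨ cong (_* R ^ n) (∑-allVec-lookup allDir n zero (λ d → 𝟙 (d ∈? exits))) ⟩
    3 * R * R ^ n               ≡⟨ solve 2 (λ r p → con 3 :* r :* p := con 3 :* p :* r) refl R (R ^ n) ⟩
    3 * R ^ n * R               ∎)
    where
    open ≡-Reasoning
    open +-*-Solver
    R = 8 ^ n
    G = ∑[ A ∈ boards n ] 𝟙 (corner A ∈? exits)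
    C = ∑[ row ∈ rows n ] 𝟙 (lookup row zero ∈? exits)

  solvableCount boardCount misses : ℕ
  solvableCount = length (solvableBoards m)
  boardCount    = 8 ^ (n * n)
  misses        = ∑ (boards n) eastMisses + ∑ (boards n) southMisses

  8^n^n≡boardCount : (8 ^ n) ^ n ≡ boardCount
  8^n^n≡boardCount = ℕ.^-*-assoc 8 n n

  solvableCount≡∑ : solvableCount ≡ ∑[ A ∈ boards n ] 𝟙 (solvable? m A)
  solvableCount≡∑ = length-filter (solvable? m) (boards n)

  solvableCount-below : 8 * solvableCount ≤ 3 * boardCount
  solvableCount-below = begin
    8 * solvableCount                            ≡⟨ cong (8 *_) solvableCount≡∑ ⟩
    8 * ∑[ A ∈ boards n ] 𝟙 (solvable? m A)      ≤⟨ ℕ.*-monoʳ-≤ 8 (∑-mono-≤ (boards n) solvable≤corner) ⟩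
    8 * ∑[ A ∈ boards n ] 𝟙 (corner A ∈? exits)  ≡⟨ ∑-corner ⟩
    3 * (8 ^ n) ^ n                              ≡⟨ cong (3 *_) 8^n^n≡boardCount ⟩
    3 * boardCount                               ∎
    where open ℕ.≤-Reasoning

  solvableCount-above : 3 * boardCount ≤ 8 * (solvableCount + misses)
  solvableCount-above = begin
    3 * boardCount                              ≡⟨ cong (3 *_) 8^n^n≡boardCount ⟨
    3 * (8 ^ n) ^ n                             ≡⟨ ∑-corner ⟨
    8 * ∑[ A ∈ boards n ] 𝟙 (corner A ∈? exits) ≤⟨ ℕ.*-monoʳ-≤ 8 (∑-mono-≤ (boards n) corner≤solvable+misses) ⟩
    8 * ∑[ A ∈ boards n ] (𝟙 (solvable? m A) + (eastMisses A + southMisses A))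
      ≡⟨ cong (8 *_) (∑-+ (boards n) _ _) ⟩
    8 * (∑[ A ∈ boards n ] 𝟙 (solvable? m A) + ∑[ A ∈ boards n ] (eastMisses A + southMisses A))
      ≡⟨ cong (8 *_) (cong₂ _+_ (sym solvableCount≡∑) (∑-+ (boards n) eastMisses southMisses)) ⟩
    8 * (solvableCount + misses)                ∎
    where open ℕ.≤-Reasoning

  misses-bound : misses * (63 + j) ≤ 63 * (2 * boardCount)
  misses-bound = geometric⇒harmonic 63 j misses (2 * boardCount) (begin
    misses * 64 ^ j
      ≡⟨ ℕ.*-distribʳ-+ (64 ^ j) (∑ (boards n) eastMisses) _ ⟩
    ∑ (boards n) eastMisses * 64 ^ j + ∑ (boards n) southMisses * 64 ^ j
      ≤⟨ ℕ.+-mono-≤ east-bound south-bound ⟩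
    63 ^ j * (8 ^ n) ^ n + 63 ^ j * (8 ^ n) ^ n
      ≡⟨ cong (λ t → 63 ^ j * t + 63 ^ j * t) 8^n^n≡boardCount ⟩
    63 ^ j * boardCount + 63 ^ j * boardCount
      ≡⟨ solve 2 (λ a t → a :* t :+ a :* t := a :* (con 2 :* t)) refl (63 ^ j) boardCount ⟩
    63 ^ j * (2 * boardCount) ∎)
    where open ℕ.≤-Reasoning
          open +-*-Solver

  -- Since misses ≤ 126 · boardCount / (63 + j), the choice j ≥ 252 Q makes misses / boardCount < 1 / Q.
  solvable-fraction-close : ∀ p Q .{{_ : ℕ.NonZero Q}} → 252 * Q ≤ j →
    ∣ over8^ n solvableCount - + 3 / 8 ∣ ℚ.< + suc p / Q
  solvable-fraction-close p Q 252Q≤j =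
    ∣c/T-a/b∣<P/Q solvableCount misses boardCount 3 8 (suc p) Q {{ℕ.m^n≢0 8 (n * n)}}
      solvableCount-below solvableCount-above (ℕ.<-≤-trans misses*Q<boardCount (ℕ.m≤m+n boardCount (p * boardCount)))
    where
    open ℕ.≤-Reasoning
    open +-*-Solver
    misses*Q<boardCount : misses * Q < boardCount
    misses*Q<boardCount = half-< (ℕ.>-nonZero⁻¹ boardCount {{ℕ.m^n≢0 8 (n * n)}}) (ℕ.*-cancelˡ-≤ 126 (begin
      126 * (2 * (misses * Q)) ≡⟨ solve 2 (λ d q → con 126 :* (con 2 :* (d :* q)) := d :* (con 252 :* q)) refl misses Q ⟩
      misses * (252 * Q)       ≤⟨ ℕ.*-monoʳ-≤ misses (ℕ.≤-trans 252Q≤j (ℕ.m≤n+m j 63)) ⟩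
      misses * (63 + j)        ≤⟨ misses-bound ⟩
      63 * (2 * boardCount)    ≡⟨ solve 1 (λ t → con 63 :* (con 2 :* t) := con 126 :* t) refl boardCount ⟩
      126 * boardCount         ∎))

open import Defs
open import Data.Nat using (ℕ; _≤_)
open import Data.Product using (Σ; ∃; _×_; _,_)
open import Data.List using (List; length)
open import Data.List.Membership.Propositional using (_∈_)
open import Data.List.Relation.Unary.Unique.Propositional using (Unique)
open import Function.Bundles using (_⇔_)
open import Data.Integer using (+_)
open import Data.Rational using (ℚ; _<_; _-_; ∣_∣; 0ℚ; _/_)

open import Data.Nat using (suc; s≤s⁻¹; _*_)
open import Relation.Binary.PropositionalEquality using (refl)
open Boards using (solvableBoards; solvableBoards-unique; ∈-solvableBoards⇔)
open Fractions using (positive-as-fraction)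

proposition3p1 : (ε : ℚ) → 0ℚ < ε →
    ∃ λ (M : ℕ) → (m : ℕ) → 1 ≤ m → M ≤ m →
      Σ (List (Board (oddSize m))) λ L →
        Unique L
        × ((A : Board (oddSize m)) → (A ∈ L) ⇔ Solvable m A)
        × ∣ over8^ (oddSize m) (length L) - (+ 3 / 8) ∣ < ε
proposition3p1 ε 0<ε with positive-as-fraction ε 0<ε
... | p , q , refl = suc (252 * suc q) , λ where
  (suc j) _ M≤m →
    solvableBoards (suc j) , solvableBoards-unique (suc j) , ∈-solvableBoards⇔ (suc j) ,
    SolvableDensity.solvable-fraction-close j p (suc q) (s≤s⁻¹ M≤m)
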